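{- Let $n>1$ and let $L$ be an integral lattice of rank $\ge n$. If $\mathcal{E}_n(L)$ is finite, then $L$ is $(n-1)$-universal, i.e. $L$ represents every integral lattice of rank $n-1$.
   Context: A lattice is a finitely generated $\mathbb{Z}$-module on a finite-dimensional positive definite quadratic space over $\mathbb{Q}$, with quadratic map $Q$ and bilinear form $B$; it is integral if $B(x,y)\in\mathbb{Z}$ for all $x,y$ in it. $M$ is represented by $L$ if there is a linear map $\sigma:M\to L$ with $Q(\sigma(x))=Q(x)$ for all $x$. $\mathcal{E}_n(L)$ is the set of isometry classes of integral lattices of rank $n$ not represented by $L$. -}

module Defs where

open import Data.Nat using (ℕ; zero; suc)
open import Data.Fin using (Fin; zero; suc)
open import Data.Integer using (ℤ; 0ℤ; _+_; _*_; _<_)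
open import Data.Product using (Σ; _×_)
open import Data.List using (List)
open import Data.List.Relation.Unary.Any using (Any)
open import Relation.Binary.PropositionalEquality using (_≡_)
open import Relation.Nullary using (¬_)

-- Vectors in ℤ^n (coordinates w.r.t. a fixed basis of the lattice).
Vecℤ : ℕ → Set
Vecℤ n = Fin n → ℤ

Σℤ : ∀ n → (Fin n → ℤ) → ℤ
Σℤ zero    f = 0ℤ
Σℤ (suc n) f = f zero + Σℤ n (λ i → f (suc i))

Q : ∀ {n} → (Fin n → Fin n → ℤ) → Vecℤ n → ℤ
Q {n} G x = Σℤ n (λ i → Σℤ n (λ j → x i * (G i j * x j)))

apply : ∀ {m k} → (Fin m → Fin k → ℤ) → Vecℤ k → Vecℤ m
apply {m} {k} T x i = Σℤ k (λ j → T i j * x j)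

NonZeroVec : ∀ {n} → Vecℤ n → Set
NonZeroVec x = ¬ (∀ i → x i ≡ 0ℤ)

-- An integral (positive definite) lattice of rank n, given by its Gram
-- matrix B(e_i,e_j) on a Z-basis: symmetric, integer entries, positive definite.
record IntLattice (n : ℕ) : Set where
  field
    gram   : Fin n → Fin n → ℤ
    sym    : ∀ i j → gram i j ≡ gram j i
    posdef : ∀ (x : Vecℤ n) → NonZeroVec x → 0ℤ < Q gram x
open IntLattice public

Represents : ∀ {m k} → IntLattice m → IntLattice k → Set
Represents {m} {k} L M =
  Σ (Fin m → Fin k → ℤ) λ T → ∀ (x : Vecℤ k) → Q (gram L) (apply T x) ≡ Q (gram M) x

Isometric : ∀ {n} → IntLattice n → IntLattice n → Set
Isometric {n} M N =
  Σ (Fin n → Fin n → ℤ) λ T → Σ (Fin n → Fin n → ℤ) λ S →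
    (∀ (x : Vecℤ n) → Q (gram N) (apply T x) ≡ Q (gram M) x)
    × (∀ (x : Vecℤ n) → ∀ i → apply S (apply T x) i ≡ x i)
    × (∀ (y : Vecℤ n) → ∀ i → apply T (apply S y) i ≡ y i)

-- 𝓔_n(L) is finite: finitely many isometry classes of integral lattices of rank n
-- are not represented by L, i.e. there is a finite list of rank-n integral lattices
-- such that every rank-n integral lattice not represented by L is isometric to one of them.
EFinite : ∀ {m} → (n : ℕ) → IntLattice m → Set
EFinite n L =
  Σ (List (IntLattice n)) λ ms →
    ∀ (M : IntLattice n) → ¬ Represents L M → Any (Isometric M) ms

Universal : ∀ {m} → ℕ → IntLattice m → Set
Universal k L = ∀ (M : IntLattice k) → Represents L M

{-# OPTIONS --safe #-}
-- If L did not represent M, it would not represent any ⟨1+a⟩ ⊕ M either. Take a beyond every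
-- diagonal entry of the finitely many exceptional lattices: an isometry from ⟨1+a⟩ ⊕ M to one of
-- them would pull its basis vectors, all of norm below 1+a, back into M, so it could not be onto.
-- This only refutes ¬(L represents M). It becomes a proof because representability is decidable:
-- the columns T eⱼ of a representation have norms M_jj, and in a positive definite lattice the
-- coordinates of vectors of bounded norm are bounded (complete the square against the first basis
-- vector and induct on the rank), so only finitely many matrices T need to be tried.
module Submission where

open import Defs
open import Data.Nat using (ℕ; zero; suc; _<_; _≤_; _∸_; z≤n; s≤s)
import Data.Nat as ℕ
import Data.Nat.Properties as ℕ
open import Data.Integer using (ℤ; +_; -_; 0ℤ; 1ℤ; _+_; _*_; _-_; ∣_∣; -[1+_]; +[1+_])
import Data.Integer as ℤ
import Data.Integer.Properties as ℤ
open import Data.Integer.Tactic.RingSolver using (solve-∀)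
open import Data.Fin using (Fin; zero; suc)
import Data.Fin.Properties as Fin
open import Data.Vec.Functional using (_∷_; head; tail)
import Data.List as List
open import Data.List.Relation.Unary.Any using (Any; here; there)
open import Data.Product using (Σ; ∃; _×_; _,_; proj₁; proj₂)
open import Data.Sum using (inj₁; inj₂; [_,_]′)
open import Data.Empty using (⊥-elim)
open import Function using (_∘_; id)
open import Relation.Nullary using (¬_; Dec; yes; no)
open import Relation.Nullary.Decidable using (map′; decidable-stable)
import Relation.Binary.PropositionalEquality as ≡
open ≡ using (_≡_; refl; cong; cong₂; subst; subst₂; trans; module ≡-Reasoning)

Matrix : ℕ → ℕ → Set
Matrix m k = Fin m → Fin k → ℤ

Symmetric : ∀ {n} → Matrix n n → Set
Symmetric G = ∀ i j → G i j ≡ G j i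

PositiveDefinite : ∀ {n} → Matrix n n → Set
PositiveDefinite {n} G = ∀ (x : Vecℤ n) → NonZeroVec x → 0ℤ ℤ.< Q G x

Σℤ-cong : ∀ n {f g : Fin n → ℤ} → (∀ i → f i ≡ g i) → Σℤ n f ≡ Σℤ n g
Σℤ-cong zero    f≗g = refl
Σℤ-cong (suc n) f≗g = cong₂ _+_ (f≗g zero) (Σℤ-cong n (f≗g ∘ suc))

Σℤ-zero : ∀ n → Σℤ n (λ _ → 0ℤ) ≡ 0ℤ
Σℤ-zero zero    = refl
Σℤ-zero (suc n) = trans (ℤ.+-identityˡ _) (Σℤ-zero n)

Σℤ-+ : ∀ n (f g : Fin n → ℤ) → Σℤ n (λ i → f i + g i) ≡ Σℤ n f + Σℤ n g
Σℤ-+ zero    f g = refl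
Σℤ-+ (suc n) f g = trans (cong (_+_ (f zero + g zero)) (Σℤ-+ n (f ∘ suc) (g ∘ suc)))
                         (interchange (f zero) (g zero) _ _)
  where
  interchange : ∀ a b c d → a + b + (c + d) ≡ a + c + (b + d)
  interchange = solve-∀

*-distribˡ-Σℤ : ∀ n c (f : Fin n → ℤ) → c * Σℤ n f ≡ Σℤ n (λ i → c * f i)
*-distribˡ-Σℤ zero    c f = ℤ.*-zeroʳ c
*-distribˡ-Σℤ (suc n) c f =
  trans (ℤ.*-distribˡ-+ c (f zero) _) (cong (_+_ (c * f zero)) (*-distribˡ-Σℤ n c (f ∘ suc)))

*-distribʳ-Σℤ : ∀ n c (f : Fin n → ℤ) → Σℤ n f * c ≡ Σℤ n (λ i → f i * c)
*-distribʳ-Σℤ n c f =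
  trans (ℤ.*-comm _ c) (trans (*-distribˡ-Σℤ n c f) (Σℤ-cong n (λ i → ℤ.*-comm c (f i))))

Σℤ-comm : ∀ n m (f : Fin n → Fin m → ℤ) →
  Σℤ n (λ i → Σℤ m (f i)) ≡ Σℤ m (λ j → Σℤ n (λ i → f i j))
Σℤ-comm zero    m f = ≡.sym (Σℤ-zero m)
Σℤ-comm (suc n) m f = trans (cong (_+_ (Σℤ m (f zero))) (Σℤ-comm n m (f ∘ suc)))
                            (≡.sym (Σℤ-+ m (f zero) (λ j → Σℤ n (λ i → f (suc i) j))))

Σℤ²-comm : ∀ m k (F : Fin m → Fin m → Fin k → Fin k → ℤ) →
  Σℤ m (λ a → Σℤ m (λ b → Σℤ k (λ i → Σℤ k (F a b i)))) ≡
  Σℤ k (λ i → Σℤ k (λ j → Σℤ m (λ a → Σℤ m (λ b → F a b i j))))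
Σℤ²-comm m k F =
  trans (Σℤ-cong m (λ a → Σℤ-comm m k (λ b i → Σℤ k (F a b i))))
  (trans (Σℤ-comm m k (λ a i → Σℤ m (λ b → Σℤ k (F a b i))))
  (trans (Σℤ-cong k (λ i → Σℤ-cong m (λ a → Σℤ-comm m k (λ b → F a b i))))
         (Σℤ-cong k (λ i → Σℤ-comm m k (λ a j → Σℤ m (λ b → F a b i j))))))

unit : ∀ {n} → Fin n → Vecℤ n
unit zero    zero    = 1ℤ
unit zero    (suc j) = 0ℤ
unit (suc i) zero    = 0ℤ
unit (suc i) (suc j) = unit i j

unit-diagonal : ∀ {n} (i : Fin n) → unit i i ≡ 1ℤ
unit-diagonal zero    = refl
unit-diagonal (suc i) = unit-diagonal i

unit-nonZero : ∀ {n} (i : Fin n) → NonZeroVec (unit i)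
unit-nonZero i unit≡0 with trans (≡.sym (unit-diagonal i)) (unit≡0 i)
... | ()

Σℤ-*unit : ∀ n (f : Fin n → ℤ) i → Σℤ n (λ j → f j * unit i j) ≡ f i
Σℤ-*unit (suc n) f zero = begin
    f zero * 1ℤ + Σℤ n (λ j → f (suc j) * 0ℤ) ≡⟨ cong₂ _+_ (ℤ.*-identityʳ (f zero)) (Σℤ-cong n (ℤ.*-zeroʳ ∘ f ∘ suc)) ⟩
    f zero + Σℤ n (λ _ → 0ℤ)                  ≡⟨ cong (_+_ (f zero)) (Σℤ-zero n) ⟩
    f zero + 0ℤ                               ≡⟨ ℤ.+-identityʳ (f zero) ⟩
    f zero                                    ∎
  where open ≡-Reasoning
Σℤ-*unit (suc n) f (suc i) =
  trans (cong (_+ Σℤ n (λ j → f (suc j) * unit i j)) (ℤ.*-zeroʳ (f zero)))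
        (trans (ℤ.+-identityˡ _) (Σℤ-*unit n (f ∘ suc) i))

Σℤ-unit* : ∀ n (f : Fin n → ℤ) i → Σℤ n (λ j → unit i j * f j) ≡ f i
Σℤ-unit* n f i = trans (Σℤ-cong n (λ j → ℤ.*-comm (unit i j) (f j))) (Σℤ-*unit n f i)

apply-unit : ∀ {m k} (T : Matrix m k) j i → apply T (unit j) i ≡ T i j
apply-unit {k = k} T j i = Σℤ-*unit k (T i) j

dot : ∀ {n} → Vecℤ n → Vecℤ n → ℤ
dot {n} x y = Σℤ n (λ j → x j * y j)

Bil : ∀ {n} → Matrix n n → Vecℤ n → Vecℤ n → ℤ
Bil {n} G x y = Σℤ n (λ a → Σℤ n (λ b → x a * (G a b * y b)))

Bil-+ˡ : ∀ {n} (G : Matrix n n) x x′ y → Bil G (λ a → x a + x′ a) y ≡ Bil G x y + Bil G x′ y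
Bil-+ˡ {n} G x x′ y = trans (Σℤ-cong n (λ a →
    trans (Σℤ-cong n (λ b → ℤ.*-distribʳ-+ (G a b * y b) (x a) (x′ a))) (Σℤ-+ n _ _)))
  (Σℤ-+ n _ _)

Bil-+ʳ : ∀ {n} (G : Matrix n n) x y y′ → Bil G x (λ b → y b + y′ b) ≡ Bil G x y + Bil G x y′
Bil-+ʳ {n} G x y y′ = trans (Σℤ-cong n (λ a →
    trans (Σℤ-cong n (λ b → distrib (x a) (G a b) (y b) (y′ b))) (Σℤ-+ n _ _)))
  (Σℤ-+ n _ _)
  where
  distrib : ∀ p q r s → p * (q * (r + s)) ≡ p * (q * r) + p * (q * s)
  distrib = solve-∀

Bil-unit : ∀ {n} (G : Matrix n n) i j → Bil G (unit i) (unit j) ≡ G i j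
Bil-unit {n} G i j = trans
  (Σℤ-cong n (λ a → trans (≡.sym (*-distribˡ-Σℤ n (unit i a) (λ b → G a b * unit j b)))
                          (cong (unit i a *_) (Σℤ-*unit n (G a) j))))
  (Σℤ-unit* n (λ a → G a j) i)

Q-unit : ∀ {n} (G : Matrix n n) i → Q G (unit i) ≡ G i i
Q-unit G i = Bil-unit G i i

Q-unit+unit : ∀ {n} (G : Matrix n n) → Symmetric G → ∀ i j →
  Q G (λ a → unit i a + unit j a) ≡ G i i + ℤ.+ 2 * G i j + G j j
Q-unit+unit G G-sym i j = begin
    Bil G (λ a → unit i a + unit j a) (λ a → unit i a + unit j a)
  ≡⟨ Bil-+ˡ G (unit i) (unit j) _ ⟩
    Bil G (unit i) (λ a → unit i a + unit j a) + Bil G (unit j) (λ a → unit i a + unit j a)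
  ≡⟨ cong₂ _+_ (Bil-+ʳ G (unit i) (unit i) (unit j)) (Bil-+ʳ G (unit j) (unit i) (unit j)) ⟩
    Bil G (unit i) (unit i) + Bil G (unit i) (unit j) + (Bil G (unit j) (unit i) + Bil G (unit j) (unit j))
  ≡⟨ cong₂ _+_ (cong₂ _+_ (Bil-unit G i i) (Bil-unit G i j)) (cong₂ _+_ (Bil-unit G j i) (Bil-unit G j j)) ⟩
    G i i + G i j + (G j i + G j j)
  ≡⟨ cong (λ t → G i i + G i j + (t + G j j)) (G-sym j i) ⟩
    G i i + G i j + (G i j + G j j)
  ≡⟨ collect (G i i) (G i j) (G j j) ⟩
    G i i + ℤ.+ 2 * G i j + G j j
  ∎
  where
  open ≡-Reasoning
  collect : ∀ p q r → p + q + (q + r) ≡ p + ℤ.+ 2 * q + r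
  collect = solve-∀

polarisation : ∀ {n} (G H : Matrix n n) → Symmetric G → Symmetric H →
  (∀ x → Q G x ≡ Q H x) → ∀ i j → G i j ≡ H i j
polarisation G H G-sym H-sym QG≗QH i j = ℤ.*-cancelˡ-≡ (ℤ.+ 2) (G i j) (H i j) (begin
    ℤ.+ 2 * G i j                            ≡⟨ isolate (G i i) (G i j) (G j j) ⟩
    G i i + ℤ.+ 2 * G i j + G j j - G i i - G j j
      ≡⟨ cong (λ t → t - G i i - G j j) (≡.sym (Q-unit+unit G G-sym i j)) ⟩
    Q G u - G i i - G j j
      ≡⟨ cong₂ (λ t s → t - s - G j j) (QG≗QH u) (QG≗QH-diag i) ⟩
    Q H u - H i i - G j j                    ≡⟨ cong (λ t → Q H u - H i i - t) (QG≗QH-diag j) ⟩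
    Q H u - H i i - H j j
      ≡⟨ cong (λ t → t - H i i - H j j) (Q-unit+unit H H-sym i j) ⟩
    H i i + ℤ.+ 2 * H i j + H j j - H i i - H j j ≡⟨ ≡.sym (isolate (H i i) (H i j) (H j j)) ⟩
    ℤ.+ 2 * H i j                            ∎)
  where
  open ≡-Reasoning
  u = λ a → unit i a + unit j a
  QG≗QH-diag : ∀ k → G k k ≡ H k k
  QG≗QH-diag k = trans (≡.sym (Q-unit G k)) (trans (QG≗QH (unit k)) (Q-unit H k))
  isolate : ∀ p q r → ℤ.+ 2 * q ≡ p + ℤ.+ 2 * q + r - p - r
  isolate = solve-∀

Q-cong : ∀ {n} (G : Matrix n n) {x y : Vecℤ n} → (∀ i → x i ≡ y i) → Q G x ≡ Q G y
Q-cong {n} G x≗y = Σℤ-cong n (λ a → Σℤ-cong n (λ b → cong₂ (λ p q → p * (G a b * q)) (x≗y a) (x≗y b)))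

Q-cong-gram : ∀ {n} {G H : Matrix n n} (x : Vecℤ n) → (∀ i j → G i j ≡ H i j) → Q G x ≡ Q H x
Q-cong-gram {n} x G≗H = Σℤ-cong n (λ a → Σℤ-cong n (λ b → cong (λ g → x a * (g * x b)) (G≗H a b)))

Q-zero : ∀ {n} (G : Matrix n n) (x : Vecℤ n) → (∀ i → x i ≡ 0ℤ) → Q G x ≡ 0ℤ
Q-zero {n} G x x≡0 = trans (Q-cong G x≡0) (trans (Σℤ-cong n (λ _ → Σℤ-zero n)) (Σℤ-zero n))

Q-nonNeg : ∀ {n} (G : Matrix n n) → PositiveDefinite G → ∀ x → 0ℤ ℤ.≤ Q G x
Q-nonNeg G G-pd x with 0ℤ ℤ.≤? Q G x
... | yes 0≤Qx = 0≤Qx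
... | no  0≰Qx = ⊥-elim (ℤ.<-asym (G-pd x x≢0) Qx<0)
  where
  Qx<0 : Q G x ℤ.< 0ℤ
  Qx<0 = ℤ.≰⇒> 0≰Qx
  x≢0 : NonZeroVec x
  x≢0 x≡0 = ℤ.<-irrefl (Q-zero G x x≡0) Qx<0

diagonal-positive : ∀ {n} (G : Matrix n n) → PositiveDefinite G → ∀ i → 0ℤ ℤ.< G i i
diagonal-positive G G-pd i = subst (0ℤ ℤ.<_) (Q-unit G i) (G-pd (unit i) (unit-nonZero i))

pullback : ∀ {m k} → Matrix m m → Matrix m k → Matrix k k
pullback {m} G T i j = Σℤ m (λ a → Σℤ m (λ b → T a i * (G a b * T b j)))

Q-apply : ∀ {m k} (G : Matrix m m) (T : Matrix m k) (x : Vecℤ k) →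
  Q G (apply T x) ≡ Q (pullback G T) x
Q-apply {m} {k} G T x =
  trans (Σℤ-cong m (λ a → Σℤ-cong m (λ b → expand-outer a b)))
  (trans (Σℤ²-comm m k (λ a b i j → x i * ((T a i * (G a b * T b j)) * x j)))
         (Σℤ-cong k (λ i → Σℤ-cong k (λ j → ≡.sym (expand-inner i j)))))
  where
  rearrange : ∀ t x g u y → (t * x) * (g * (u * y)) ≡ x * ((t * (g * u)) * y)
  rearrange = solve-∀
  expand-outer : ∀ a b → apply T x a * (G a b * apply T x b) ≡
    Σℤ k (λ i → Σℤ k (λ j → x i * ((T a i * (G a b * T b j)) * x j)))
  expand-outer a b =
    trans (cong (apply T x a *_) (*-distribˡ-Σℤ k (G a b) (λ j → T b j * x j)))
    (trans (*-distribʳ-Σℤ k _ (λ i → T a i * x i))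
    (Σℤ-cong k (λ i → trans (*-distribˡ-Σℤ k (T a i * x i) (λ j → G a b * (T b j * x j)))
      (Σℤ-cong k (λ j → rearrange (T a i) (x i) (G a b) (T b j) (x j))))))
  expand-inner : ∀ i j → x i * (pullback G T i j * x j) ≡
    Σℤ m (λ a → Σℤ m (λ b → x i * ((T a i * (G a b * T b j)) * x j)))
  expand-inner i j =
    trans (cong (x i *_) (trans (*-distribʳ-Σℤ m (x j) _) (Σℤ-cong m (λ a → *-distribʳ-Σℤ m (x j) _))))
    (trans (*-distribˡ-Σℤ m (x i) _) (Σℤ-cong m (λ a → *-distribˡ-Σℤ m (x i) _)))

pullback-sym : ∀ {m k} {G : Matrix m m} → Symmetric G → (T : Matrix m k) → Symmetric (pullback G T)
pullback-sym {m} {G = G} G-sym T i j =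
  trans (Σℤ-comm m m (λ a b → T a i * (G a b * T b j)))
  (Σℤ-cong m (λ b → Σℤ-cong m (λ a →
    trans (cong (λ g → T a i * (g * T b j)) (G-sym a b)) (swap (T a i) (G b a) (T b j)))))
  where
  swap : ∀ p g q → p * (g * q) ≡ q * (g * p)
  swap = solve-∀

pullback-cong : ∀ {m k} (G : Matrix m m) {S T : Matrix m k} → (∀ a i → S a i ≡ T a i) →
  ∀ i j → pullback G S i j ≡ pullback G T i j
pullback-cong {m} G S≗T i j =
  Σℤ-cong m (λ a → Σℤ-cong m (λ b → cong₂ (λ s t → s * (G a b * t)) (S≗T a i) (S≗T b j)))

pullback⇒represents : ∀ {m k} (L : IntLattice m) (M : IntLattice k) (T : Matrix m k) →
  (∀ i j → pullback (gram L) T i j ≡ gram M i j) → Represents L M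
pullback⇒represents L M T T-pulls = T , λ x → trans (Q-apply (gram L) T x) (Q-cong-gram x T-pulls)

represents⇒pullback : ∀ {m k} (L : IntLattice m) (M : IntLattice k) (T : Matrix m k) →
  (∀ x → Q (gram L) (apply T x) ≡ Q (gram M) x) → ∀ i j → pullback (gram L) T i j ≡ gram M i j
represents⇒pullback L M T T-isometric = polarisation _ (gram M) (pullback-sym (sym L) T) (sym M)
  (λ x → trans (≡.sym (Q-apply (gram L) T x)) (T-isometric x))

Σℕ : ∀ n → (Fin n → ℕ) → ℕ
Σℕ zero    f = 0
Σℕ (suc n) f = f zero ℕ.+ Σℕ n (f ∘ suc)

∣Σℤ∣≤Σℕ∣∣ : ∀ n (f : Fin n → ℤ) → ∣ Σℤ n f ∣ ≤ Σℕ n (∣_∣ ∘ f)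
∣Σℤ∣≤Σℕ∣∣ zero    f = z≤n
∣Σℤ∣≤Σℕ∣∣ (suc n) f =
  ℕ.≤-trans (ℤ.∣i+j∣≤∣i∣+∣j∣ (f zero) _) (ℕ.+-monoʳ-≤ ∣ f zero ∣ (∣Σℤ∣≤Σℕ∣∣ n (f ∘ suc)))

Σℕ-mono-≤ : ∀ n {f g : Fin n → ℕ} → (∀ i → f i ≤ g i) → Σℕ n f ≤ Σℕ n g
Σℕ-mono-≤ zero    f≤g = z≤n
Σℕ-mono-≤ (suc n) f≤g = ℕ.+-mono-≤ (f≤g zero) (Σℕ-mono-≤ n (f≤g ∘ suc))

≤Σℕ : ∀ n (f : Fin n → ℕ) i → f i ≤ Σℕ n f
≤Σℕ (suc n) f zero    = ℕ.m≤m+n (f zero) _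
≤Σℕ (suc n) f (suc i) = ℕ.≤-trans (≤Σℕ n (f ∘ suc) i) (ℕ.m≤n+m _ (f zero))

∣dot∣≤ : ∀ {n} (x y : Vecℤ n) {B} → (∀ j → ∣ y j ∣ ≤ B) → ∣ dot x y ∣ ≤ Σℕ n (λ j → ∣ x j ∣ ℕ.* B)
∣dot∣≤ {n} x y {B} y≤B = ℕ.≤-trans (∣Σℤ∣≤Σℕ∣∣ n (λ j → x j * y j)) (Σℕ-mono-≤ n (λ j →
  ℕ.≤-trans (ℕ.≤-reflexive (ℤ.abs-* (x j) (y j))) (ℕ.*-monoʳ-≤ ∣ x j ∣ (y≤B j))))

dot-scale : ∀ {n} (x : Vecℤ n) k (y : Vecℤ n) → dot x (λ i → k * y i) ≡ k * dot x y
dot-scale {n} x k y = trans (Σℤ-cong n (λ j → rearrange (x j) k (y j))) (≡.sym (*-distribˡ-Σℤ n k _))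
  where
  rearrange : ∀ x k y → x * (k * y) ≡ k * (x * y)
  rearrange = solve-∀

Q-scale : ∀ {n} (G : Matrix n n) k (x : Vecℤ n) → Q G (λ i → k * x i) ≡ (k * k) * Q G x
Q-scale {n} G k x = trans (Σℤ-cong n (λ a → Σℤ-cong n (λ b → rearrange k (x a) (G a b) (x b))))
  (≡.sym (trans (*-distribˡ-Σℤ n (k * k) _) (Σℤ-cong n (λ a → *-distribˡ-Σℤ n (k * k) _))))
  where
  rearrange : ∀ k x g y → k * x * (g * (k * y)) ≡ k * k * (x * (g * y))
  rearrange = solve-∀

i*i≡∣i∣*∣i∣ : ∀ i → i * i ≡ + (∣ i ∣ ℕ.* ∣ i ∣)
i*i≡∣i∣*∣i∣ (+ n)    = ≡.sym (ℤ.pos-* n n)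
i*i≡∣i∣*∣i∣ -[1+ n ] = refl

0≤i*i : ∀ i → 0ℤ ℤ.≤ i * i
0≤i*i i = subst (0ℤ ℤ.≤_) (≡.sym (i*i≡∣i∣*∣i∣ i)) (ℤ.+≤+ z≤n)

n≤n*n : ∀ n → n ≤ n ℕ.* n
n≤n*n zero    = z≤n
n≤n*n (suc n) = ℕ.m≤m*n (suc n) (suc n)

square+nonNeg-bounded : ∀ {a q s d : ℤ} {c} → 0ℤ ℤ.< a → a * q ≡ s * s + d → 0ℤ ℤ.≤ d →
  q ℤ.≤ + c → d ℤ.≤ + (∣ a ∣ ℕ.* c) × ∣ s ∣ ≤ ∣ a ∣ ℕ.* c
square+nonNeg-bounded {+[1+ n ]} {q} {s} {d} {c} _ aq≡s²+d 0≤d q≤c =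
  ℤ.≤-trans (ℤ.i≤j+i d (s * s) {{ℤ.nonNegative (0≤i*i s)}}) s²+d≤ac ,
  ℕ.≤-trans (n≤n*n ∣ s ∣) (ℤ.drop‿+≤+ (subst (ℤ._≤ _) (i*i≡∣i∣*∣i∣ s)
    (ℤ.≤-trans (ℤ.i≤i+j (s * s) d {{ℤ.nonNegative 0≤d}}) s²+d≤ac)))
  where
  s²+d≤ac : s * s + d ℤ.≤ + (suc n ℕ.* c)
  s²+d≤ac = subst₂ ℤ._≤_ aq≡s²+d (≡.sym (ℤ.pos-* (suc n) c)) (ℤ.*-monoˡ-≤-nonNeg +[1+ n ] q≤c)
square+nonNeg-bounded {+ zero} (ℤ.+<+ ())

∣i∣≤∣a*i∣ : ∀ {a} → 0ℤ ℤ.< a → ∀ i → ∣ i ∣ ≤ ∣ a * i ∣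
∣i∣≤∣a*i∣ {+[1+ n ]} _ i = ℕ.≤-trans (ℕ.m≤n*m ∣ i ∣ (suc n)) (ℕ.≤-reflexive (≡.sym (ℤ.abs-* +[1+ n ] i)))
∣i∣≤∣a*i∣ {+ zero}     (ℤ.+<+ ())

BoundedShortVectors : ∀ {n} → Matrix n n → Set
BoundedShortVectors {n} G = ∀ c → Σ ℕ λ B → ∀ (v : Vecℤ n) → Q G v ℤ.≤ + c → ∀ i → ∣ v i ∣ ≤ B

module Schur {m : ℕ} (G : Matrix (suc m) (suc m)) (G-sym : Symmetric G) where

  a : ℤ
  a = G zero zero

  b : Vecℤ m
  b = tail (G zero)

  C : Matrix m m
  C i j = G (suc i) (suc j)

  -- a (C − b bᵀ / a): the Schur complement of a, scaled by a to stay integral.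
  complement : Matrix m m
  complement i j = a * C i j - b i * b j

  complement-sym : Symmetric complement
  complement-sym i j = cong₂ (λ c e → a * c - e) (G-sym (suc i) (suc j)) (ℤ.*-comm (b i) (b j))

  Q-split : ∀ v → Q G v ≡
    head v * (a * head v) + (head v * dot b (tail v) + head v * dot b (tail v)) + Q C (tail v)
  Q-split v = begin
      x + first-row + Σℤ m (λ i → first-column i + Σℤ m (λ j → w i * (C i j * w j)))
    ≡⟨ cong (_+_ (x + first-row)) (Σℤ-+ m first-column _) ⟩
      x + first-row + (Σℤ m first-column + Q C w)
    ≡⟨ cong₂ (λ p q → x + p + (q + Q C w)) first-row≡ first-column≡ ⟩
      x + head v * dot b w + (head v * dot b w + Q C w)
    ≡⟨ reassociate x (head v * dot b w) (Q C w) ⟩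
      x + (head v * dot b w + head v * dot b w) + Q C w
    ∎
    where
    open ≡-Reasoning
    w = tail v
    x = head v * (a * head v)
    first-row = Σℤ m (λ j → head v * (b j * w j))
    first-column : Fin m → ℤ
    first-column i = w i * (G (suc i) zero * head v)
    first-row≡ : first-row ≡ head v * dot b w
    first-row≡ = ≡.sym (*-distribˡ-Σℤ m (head v) (λ j → b j * w j))
    swap : ∀ p g q → p * (g * q) ≡ q * (g * p)
    swap = solve-∀
    first-column≡ : Σℤ m first-column ≡ head v * dot b w
    first-column≡ = trans (Σℤ-cong m (λ i →
      trans (cong (λ g → w i * (g * head v)) (G-sym (suc i) zero)) (swap (w i) (b i) (head v)))) first-row≡
    reassociate : ∀ x s q → x + s + (s + q) ≡ x + (s + s) + q
    reassociate = solve-∀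

  Q-complement : ∀ w → Q complement w ≡ a * Q C w - dot b w * dot b w
  Q-complement w = begin
      Σℤ m (λ i → Σℤ m (λ j → w i * ((a * C i j - b i * b j) * w j)))
    ≡⟨ Σℤ-cong m (λ i → trans (Σℤ-cong m (λ j → expand (w i) a (C i j) (b i) (b j) (w j))) (Σℤ-+ m _ _)) ⟩
      Σℤ m (λ i → Σℤ m (λ j → a * (w i * (C i j * w j))) + Σℤ m (λ j → - 1ℤ * ((b i * w i) * (b j * w j))))
    ≡⟨ Σℤ-+ m _ _ ⟩
      Σℤ m (λ i → Σℤ m (λ j → a * (w i * (C i j * w j)))) + Σℤ m (λ i → Σℤ m (λ j → - 1ℤ * ((b i * w i) * (b j * w j))))
    ≡⟨ cong₂ _+_ (≡.sym (factor a (λ i j → w i * (C i j * w j)))) (≡.sym (factor (- 1ℤ) (λ i j → (b i * w i) * (b j * w j)))) ⟩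
      a * Q C w + - 1ℤ * Σℤ m (λ i → Σℤ m (λ j → (b i * w i) * (b j * w j)))
    ≡⟨ cong (λ t → a * Q C w + - 1ℤ * t) dot²≡ ⟩
      a * Q C w + - 1ℤ * (dot b w * dot b w)
    ≡⟨ neg (a * Q C w) (dot b w) ⟩
      a * Q C w - dot b w * dot b w
    ∎
    where
    open ≡-Reasoning
    expand : ∀ x a g p q y → x * ((a * g - p * q) * y) ≡ a * (x * (g * y)) + - 1ℤ * ((p * x) * (q * y))
    expand = solve-∀
    neg : ∀ s d → s + - 1ℤ * (d * d) ≡ s - d * d
    neg = solve-∀
    factor : ∀ k (F : Fin m → Fin m → ℤ) → k * Σℤ m (λ i → Σℤ m (F i)) ≡ Σℤ m (λ i → Σℤ m (λ j → k * F i j))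
    factor k F = trans (*-distribˡ-Σℤ m k _) (Σℤ-cong m (λ i → *-distribˡ-Σℤ m k (F i)))
    dot²≡ : Σℤ m (λ i → Σℤ m (λ j → (b i * w i) * (b j * w j))) ≡ dot b w * dot b w
    dot²≡ = ≡.sym (trans (*-distribʳ-Σℤ m (dot b w) _) (Σℤ-cong m (λ i → *-distribˡ-Σℤ m (b i * w i) _)))

  complete-square : ∀ v → let s = a * head v + dot b (tail v) in a * Q G v ≡ s * s + Q complement (tail v)
  complete-square v = trans (cong (a *_) (Q-split v))
    (trans (identity a (head v) (dot b (tail v)) (Q C (tail v)))
           (cong (_+_ (s * s)) (≡.sym (Q-complement (tail v)))))
    where
    s = a * head v + dot b (tail v)
    identity : ∀ a x d q → a * (x * (a * x) + (x * d + x * d) + q) ≡ (a * x + d) * (a * x + d) + (a * q - d * d)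
    identity = solve-∀

  lift : Vecℤ m → Vecℤ (suc m)
  lift w = - dot b w ∷ (λ i → a * w i)

  Q-lift : ∀ w → Q G (lift w) ≡ a * Q complement w
  Q-lift w = begin
      Q G (lift w)
    ≡⟨ Q-split (lift w) ⟩
      - d * (a * - d) + (- d * dot b (λ i → a * w i) + - d * dot b (λ i → a * w i)) + Q C (λ i → a * w i)
    ≡⟨ cong₂ (λ p q → - d * (a * - d) + (- d * p + - d * p) + q) (dot-scale b a w) (Q-scale C a w) ⟩
      - d * (a * - d) + (- d * (a * d) + - d * (a * d)) + a * a * Q C w
    ≡⟨ identity a (Q C w) d ⟩
      a * (a * Q C w - d * d)
    ≡⟨ cong (a *_) (≡.sym (Q-complement w)) ⟩
      a * Q complement w
    ∎
    where
    open ≡-Reasoning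
    d = dot b w
    identity : ∀ a q d → - d * (a * - d) + (- d * (a * d) + - d * (a * d)) + a * a * q ≡ a * (a * q - d * d)
    identity = solve-∀

  module _ (G-pd : PositiveDefinite G) where

    a-positive : 0ℤ ℤ.< a
    a-positive = diagonal-positive G G-pd zero

    complement-posdef : PositiveDefinite complement
    complement-posdef w w≢0 = ℤ.*-cancelˡ-<-nonNeg a {{ℤ.nonNegative (ℤ.<⇒≤ a-positive)}}
      (subst₂ ℤ._<_ (≡.sym (ℤ.*-zeroʳ a)) (Q-lift w) (G-pd (lift w) lift≢0))
      where
      lift≢0 : NonZeroVec (lift w)
      lift≢0 lift≡0 = w≢0 λ i → [ (λ a≡0 → ⊥-elim (ℤ.<⇒≢ a-positive (≡.sym a≡0))) , id ]′
        (ℤ.i*j≡0⇒i≡0∨j≡0 a (lift≡0 (suc i)))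

    short-vectors-bounded-step : BoundedShortVectors complement → BoundedShortVectors G
    short-vectors-bounded-step complement-bounded c = Bₕ ℕ.+ Bₜ , bounded
      where
      ac = ∣ a ∣ ℕ.* c
      Bₜ = proj₁ (complement-bounded ac)
      Bₕ = ac ℕ.+ Σℕ m (λ j → ∣ b j ∣ ℕ.* Bₜ)
      bounded : ∀ v → Q G v ℤ.≤ + c → ∀ i → ∣ v i ∣ ≤ Bₕ ℕ.+ Bₜ
      bounded v Qv≤c = λ { zero    → ℕ.≤-trans head-bounded (ℕ.m≤m+n Bₕ Bₜ)
                         ; (suc i) → ℕ.≤-trans (tail-bounded i) (ℕ.m≤n+m Bₜ Bₕ) }
        where
        d = dot b (tail v)
        s = a * head v + d
        bounds = square+nonNeg-bounded {s = s} {d = Q complement (tail v)} a-positive (complete-square v)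
                   (Q-nonNeg complement complement-posdef (tail v)) Qv≤c
        tail-bounded : ∀ i → ∣ tail v i ∣ ≤ Bₜ
        tail-bounded = proj₂ (complement-bounded ac) (tail v) (proj₁ bounds)
        head-bounded : ∣ head v ∣ ≤ Bₕ
        head-bounded = begin
          ∣ head v ∣          ≤⟨ ∣i∣≤∣a*i∣ a-positive (head v) ⟩
          ∣ a * head v ∣      ≡⟨ cong ∣_∣ (cancel (a * head v) d) ⟩
          ∣ s - d ∣           ≤⟨ ℤ.∣i-j∣≤∣i∣+∣j∣ s d ⟩
          ∣ s ∣ ℕ.+ ∣ d ∣     ≤⟨ ℕ.+-mono-≤ (proj₂ bounds) (∣dot∣≤ b (tail v) tail-bounded) ⟩
          Bₕ                  ∎
          where
          open ℕ.≤-Reasoning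
          cancel : ∀ x d → x ≡ x + d - d
          cancel = solve-∀

short-vectors-bounded : ∀ {n} (G : Matrix n n) → Symmetric G → PositiveDefinite G → BoundedShortVectors G
short-vectors-bounded {zero}  G G-sym G-pd c = 0 , λ _ _ ()
short-vectors-bounded {suc m} G G-sym G-pd   =
  short-vectors-bounded-step G-pd (short-vectors-bounded complement complement-sym (complement-posdef G-pd))
  where open Schur G G-sym

-- Functions are only compared pointwise, hence the predicates searched must respect _≈_.
BoundedSearch : (A : Set) → (A → A → Set) → (A → Set) → Set₁
BoundedSearch A _≈_ Bounded = ∀ (P : A → Set) → (∀ {x y} → x ≈ y → P x → P y) → (∀ x → Dec (P x)) →
  Dec (∃ λ x → Bounded x × P x)

search-ℤ : ∀ B → BoundedSearch ℤ _≡_ (λ z → ∣ z ∣ ≤ B)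
search-ℤ zero P _ P? with P? 0ℤ
... | yes P0 = yes (0ℤ , z≤n , P0)
... | no ¬P0 = no λ { (+ zero , _ , P0) → ¬P0 P0 }
search-ℤ (suc B) P P-resp P? with search-ℤ B P P-resp P? | P? (+ suc B) | P? -[1+ B ]
... | yes (z , z≤B , Pz) | _ | _ = yes (z , ℕ.m≤n⇒m≤1+n z≤B , Pz)
... | no _ | yes P+ | _     = yes (+ suc B , ℕ.≤-refl , P+)
... | no _ | no _   | yes P- = yes (-[1+ B ] , ℕ.≤-refl , P-)
... | no ¬inner | no ¬P+ | no ¬P- = no outer
  where
  outer : ¬ (∃ λ z → ∣ z ∣ ≤ suc B × P z)
  outer (z , z≤1+B , Pz) with ℕ.m≤n⇒m<n∨m≡n z≤1+B
  ... | inj₁ (s≤s z≤B) = ¬inner (z , z≤B , Pz)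
  outer (+ _    , _ , Pz) | inj₂ refl = ¬P+ Pz
  outer (-[1+ _ ] , _ , Pz) | inj₂ refl = ¬P- Pz

search-Π : ∀ {A : Set} {_≈_ : A → A → Set} {Bounded : A → Set} → (∀ x → x ≈ x) →
  BoundedSearch A _≈_ Bounded →
  ∀ n → BoundedSearch (Fin n → A) (λ f g → ∀ i → f i ≈ g i) (λ f → ∀ i → Bounded (f i))
search-Π ≈-refl search-A zero P P-resp P? with P? (λ ())
... | yes P[] = yes ((λ ()) , (λ ()) , P[])
... | no ¬P[] = no λ (f , _ , Pf) → ¬P[] (P-resp (λ ()) Pf)
search-Π {A} {_≈_} {Bounded} ≈-refl search-A (suc n) P P-resp P? =
  map′ extend restrict (search-A Extendable Extendable-resp Extendable?)
  where
  Extendable : A → Set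
  Extendable x = ∃ λ f → (∀ i → Bounded (f i)) × P (x ∷ f)
  Extendable-resp : ∀ {x y} → x ≈ y → Extendable x → Extendable y
  Extendable-resp x≈y (f , f-bounded , Px∷f) =
    f , f-bounded , P-resp (λ { zero → x≈y ; (suc i) → ≈-refl (f i) }) Px∷f
  Extendable? : ∀ x → Dec (Extendable x)
  Extendable? x = search-Π ≈-refl search-A n (P ∘ (x ∷_))
    (λ f≈g → P-resp (λ { zero → ≈-refl x ; (suc i) → f≈g i })) (P? ∘ (x ∷_))
  extend : (∃ λ x → Bounded x × Extendable x) → ∃ λ f → (∀ i → Bounded (f i)) × P f
  extend (x , x-bounded , f , f-bounded , Px∷f) =
    x ∷ f , (λ { zero → x-bounded ; (suc i) → f-bounded i }) , Px∷f
  restrict : (∃ λ f → (∀ i → Bounded (f i)) × P f) → ∃ λ x → Bounded x × Extendable x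
  restrict (f , f-bounded , Pf) = head f , f-bounded zero , tail f , f-bounded ∘ suc ,
    P-resp (λ { zero → ≈-refl (f zero) ; (suc i) → ≈-refl (f (suc i)) }) Pf

search-matrix : ∀ m k B → BoundedSearch (Matrix m k) (λ S T → ∀ i j → S i j ≡ T i j)
  (λ T → ∀ i j → ∣ T i j ∣ ≤ B)
search-matrix m k B = search-Π (λ _ _ → refl) (search-Π (λ _ → refl) (search-ℤ B) k) m

z≤+∣z∣ : ∀ z → z ℤ.≤ + ∣ z ∣
z≤+∣z∣ (+ n)    = ℤ.≤-refl
z≤+∣z∣ -[1+ n ] = ℤ.-≤+

absTrace : ∀ {n} → IntLattice n → ℕ
absTrace {n} M = Σℕ n (λ j → ∣ gram M j j ∣)

gram-diagonal≤absTrace : ∀ {n} (M : IntLattice n) j → gram M j j ℤ.≤ + absTrace M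
gram-diagonal≤absTrace {n} M j =
  ℤ.≤-trans (z≤+∣z∣ (gram M j j)) (ℤ.+≤+ (≤Σℕ n (λ j → ∣ gram M j j ∣) j))

representation-entries-bounded : ∀ {m k} (L : IntLattice m) (M : IntLattice k) →
  Σ ℕ λ B → ∀ T → (∀ x → Q (gram L) (apply T x) ≡ Q (gram M) x) → ∀ i j → ∣ T i j ∣ ≤ B
representation-entries-bounded L M = B , entries-bounded
  where
  short-bound = short-vectors-bounded (gram L) (sym L) (posdef L) (absTrace M)
  B = proj₁ short-bound
  entries-bounded : ∀ T → (∀ x → Q (gram L) (apply T x) ≡ Q (gram M) x) → ∀ i j → ∣ T i j ∣ ≤ B
  entries-bounded T T-isometric i j = subst (λ t → ∣ t ∣ ≤ B) (apply-unit T j i)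
    (proj₂ short-bound (apply T (unit j)) image-short i)
    where
    image-short : Q (gram L) (apply T (unit j)) ℤ.≤ + absTrace M
    image-short = subst (ℤ._≤ _) (≡.sym (trans (T-isometric (unit j)) (Q-unit (gram M) j)))
                    (gram-diagonal≤absTrace M j)

represents? : ∀ {m k} (L : IntLattice m) (M : IntLattice k) → Dec (Represents L M)
represents? {m} {k} L M = map′
  (λ (T , _ , T-pulls) → pullback⇒represents L M T T-pulls)
  (λ (T , T-isometric) → T , entries-bounded T T-isometric , represents⇒pullback L M T T-isometric)
  (search-matrix m k B Pulls (λ S≗T S-pulls i j → trans (≡.sym (pullback-cong (gram L) S≗T i j)) (S-pulls i j))
    (λ T → Fin.all? λ i → Fin.all? λ j → pullback (gram L) T i j ℤ.≟ gram M i j))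
  where
  B = proj₁ (representation-entries-bounded L M)
  entries-bounded = proj₂ (representation-entries-bounded L M)
  Pulls : Matrix m k → Set
  Pulls T = ∀ i j → pullback (gram L) T i j ≡ gram M i j

a≤i*[a*i] : ∀ a {i} → ¬ i ≡ 0ℤ → + a ℤ.≤ i * (+ a * i)
a≤i*[a*i] a {i} i≢0 = begin
  + a                              ≤⟨ ℤ.+≤+ (ℕ.m≤m*n a (∣ i ∣ ℕ.* ∣ i ∣) {{ℕ.m*n≢0 ∣ i ∣ ∣ i ∣ {{i≢0′}} {{i≢0′}}}}) ⟩
  + (a ℕ.* (∣ i ∣ ℕ.* ∣ i ∣))       ≡⟨ ℤ.pos-* a _ ⟩
  + a * + (∣ i ∣ ℕ.* ∣ i ∣)         ≡⟨ cong (+ a *_) (≡.sym (i*i≡∣i∣*∣i∣ i)) ⟩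
  + a * (i * i)                    ≡⟨ rearrange (+ a) i ⟩
  i * (+ a * i)                    ∎
  where
  open ℤ.≤-Reasoning
  i≢0′ = ℤ.≢-nonZero i≢0
  rearrange : ∀ a i → a * (i * i) ≡ i * (a * i)
  rearrange = solve-∀

module RankOneSum {p : ℕ} (a : ℕ) (M : IntLattice p) where

  A : ℤ
  A = +[1+ a ]

  G : Matrix (suc p) (suc p)
  G zero    zero    = A
  G zero    (suc j) = 0ℤ
  G (suc i) zero    = 0ℤ
  G (suc i) (suc j) = gram M i j

  G-sym : Symmetric G
  G-sym zero    zero    = refl
  G-sym zero    (suc j) = refl
  G-sym (suc i) zero    = refl
  G-sym (suc i) (suc j) = sym M i j

  Q-G : ∀ v → Q G v ≡ head v * (A * head v) + Q (gram M) (tail v)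
  Q-G v = trans (Q-split v) (trans
    (cong (λ t → head v * (A * head v) + (head v * t + head v * t) + Q (gram M) (tail v)) (Σℤ-zero p))
    (drop-cross-terms (head v * (A * head v)) (head v) (Q (gram M) (tail v))))
    where
    open Schur G G-sym using (Q-split)
    drop-cross-terms : ∀ x y q → x + (y * 0ℤ + y * 0ℤ) + q ≡ x + q
    drop-cross-terms = solve-∀

  A≤Q-G : ∀ v → ¬ head v ≡ 0ℤ → A ℤ.≤ Q G v
  A≤Q-G v v₀≢0 = begin
    A                                                ≤⟨ a≤i*[a*i] (suc a) v₀≢0 ⟩
    head v * (A * head v)                            ≤⟨ ℤ.i≤i+j _ _ {{ℤ.nonNegative (Q-nonNeg (gram M) (posdef M) (tail v))}} ⟩
    head v * (A * head v) + Q (gram M) (tail v)      ≡⟨ ≡.sym (Q-G v) ⟩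
    Q G v                                            ∎
    where open ℤ.≤-Reasoning

  G-posdef : PositiveDefinite G
  G-posdef v v≢0 with head v ℤ.≟ 0ℤ
  ... | no v₀≢0 = ℤ.<-≤-trans (ℤ.+<+ (s≤s z≤n)) (A≤Q-G v v₀≢0)
  ... | yes v₀≡0 = subst (0ℤ ℤ.<_) (≡.sym Q-G≡Q-M) (posdef M (tail v) tail≢0)
    where
    Q-G≡Q-M : Q G v ≡ Q (gram M) (tail v)
    Q-G≡Q-M = trans (Q-G v) (trans (cong (λ t → t * (A * t) + Q (gram M) (tail v)) v₀≡0) (ℤ.+-identityˡ _))
    tail≢0 : NonZeroVec (tail v)
    tail≢0 tail≡0 = v≢0 λ { zero → v₀≡0 ; (suc i) → tail≡0 i }

  lattice : IntLattice (suc p)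
  lattice = record { gram = G ; sym = G-sym ; posdef = G-posdef }

  short⇒head≡0 : ∀ v → Q G v ℤ.< A → head v ≡ 0ℤ
  short⇒head≡0 v Qv<A with head v ℤ.≟ 0ℤ
  ... | yes v₀≡0 = v₀≡0
  ... | no v₀≢0 = ⊥-elim (ℤ.<⇒≱ Qv<A (A≤Q-G v v₀≢0))

  represents-sum⇒represents : ∀ {m} (L : IntLattice m) → Represents L lattice → Represents L M
  represents-sum⇒represents L (T , T-isometric) = T′ , λ x → begin
      Q (gram L) (apply T′ x)            ≡⟨ Q-cong (gram L) (apply-0∷ x) ⟩
      Q (gram L) (apply T (0ℤ ∷ x))      ≡⟨ T-isometric (0ℤ ∷ x) ⟩
      Q G (0ℤ ∷ x)                       ≡⟨ trans (Q-G (0ℤ ∷ x)) (ℤ.+-identityˡ _) ⟩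
      Q (gram M) x                       ∎
    where
    open ≡-Reasoning
    T′ = tail ∘ T
    apply-0∷ : ∀ x i → apply T′ x i ≡ apply T (0ℤ ∷ x) i
    apply-0∷ x i = ≡.sym (trans (cong (_+ apply T′ x i) (ℤ.*-zeroʳ (T i zero))) (ℤ.+-identityˡ _))

  -- S sends each basis vector of N, of norm below A, to a vector with first coordinate 0,
  -- so S ∘ T cannot fix the first basis vector.
  ¬isometric-to-smaller-diagonal : (N : IntLattice (suc p)) → (∀ j → gram N j j ℤ.< A) → ¬ Isometric lattice N
  ¬isometric-to-smaller-diagonal N N-diagonal<A (T , S , T-isometric , ST≗id , TS≗id) = 1≢0 ST-unit-head
    where
    1≢0 : ¬ 1ℤ ≡ 0ℤ
    1≢0 ()
    S-head≡0 : ∀ j → S zero j ≡ 0ℤ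
    S-head≡0 j = trans (≡.sym (apply-unit S j zero)) (short⇒head≡0 (apply S (unit j))
      (subst (ℤ._< A) (≡.sym Q-Sunit) (N-diagonal<A j)))
      where
      Q-Sunit : Q G (apply S (unit j)) ≡ gram N j j
      Q-Sunit = trans (≡.sym (T-isometric (apply S (unit j))))
                  (trans (Q-cong (gram N) (TS≗id (unit j))) (Q-unit (gram N) j))
    ST-unit-head : 1ℤ ≡ 0ℤ
    ST-unit-head = trans (≡.sym (ST≗id (unit zero) zero))
      (trans (Σℤ-cong (suc p) (λ b → cong (_* apply T (unit zero) b) (S-head≡0 b))) (Σℤ-zero (suc p)))

⟨1+_⟩⊕_ : ∀ {p} → ℕ → IntLattice p → IntLattice (suc p)
⟨1+ a ⟩⊕ M = RankOneSum.lattice a M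

absTraceSum : ∀ {n} → List.List (IntLattice n) → ℕ
absTraceSum List.[]       = 0
absTraceSum (N List.∷ Ns) = absTrace N ℕ.+ absTraceSum Ns

⊕-∉ : ∀ {p} (M : IntLattice p) (Ns : List.List (IntLattice (suc p))) a → absTraceSum Ns ≤ a →
  ¬ Any (Isometric (⟨1+ a ⟩⊕ M)) Ns
⊕-∉ M (N List.∷ Ns) a Ns≤a (here iso) =
  RankOneSum.¬isometric-to-smaller-diagonal a M N (λ j → ℤ.≤-<-trans (gram-diagonal≤absTrace N j)
    (ℤ.+<+ (s≤s (ℕ.≤-trans (ℕ.m≤m+n (absTrace N) (absTraceSum Ns)) Ns≤a)))) iso
⊕-∉ M (N List.∷ Ns) a Ns≤a (there iso) =
  ⊕-∉ M Ns a (ℕ.≤-trans (ℕ.m≤n+m (absTraceSum Ns) (absTrace N)) Ns≤a) iso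

lemma2p4 : ∀ (n m : ℕ) → 1 < n → n ≤ m → (L : IntLattice m) →
    EFinite n L → ∀ (M : IntLattice (n ∸ 1)) → Represents L M
lemma2p4 zero    _ () _ _ _ _
lemma2p4 (suc n) m _ _ L (Ns , unrepresented-classified) M =
  decidable-stable (represents? L M) λ ¬L-represents-M →
    let a = absTraceSum Ns in
    ⊕-∉ M Ns a ℕ.≤-refl (unrepresented-classified (⟨1+ a ⟩⊕ M)
      (¬L-represents-M ∘ RankOneSum.represents-sum⇒represents a M L))
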